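{- Let $X$ be a finite set of names and $a$ a name with $a\notin X$. Every named Boolean formula $\mathscr b$ with $\mathrm{FN}(\mathscr b)\subseteq X\cup\{a\}$ admits an $a$-decomposition in $X$.
   Context: Named Boolean formulas: $\mathscr b,\mathscr c::=x^a_i\mid\top\mid\bot\mid\neg\mathscr b\mid\mathscr b\wedge\mathscr c\mid\mathscr b\vee\mathscr c$, with $i\in\mathbb N$ and $a$ a name; $\mathrm{FN}(\mathscr b)$ is the set of names occurring. For a finite set of names $X\supseteq\mathrm{FN}(\mathscr b)$, $[\![\mathscr b]\!]_X\subseteq(2^\omega)^X$ (maps $X\to\{0,1\}^{\mathbb N}$) is: $[\![x^a_i]\!]_X=\{f\mid f(a)(i)=1\}$, $[\![\top]\!]_X=(2^\omega)^X$, $[\![\bot]\!]_X=\emptyset$, and $\neg,\wedge,\vee$ as complement, intersection, union. An $a$-decomposition of $\mathscr b$ (with $\mathrm{FN}(\mathscr b)\subseteq X\cup\{a\}$, $a\notin X$) is a named Boolean formula $\mathscr c=\bigvee_{i=0}^{k-1}\mathscr d_i\wedge\mathscr e_i$ such that $[\![\mathscr c]\!]_{X\cup\{a\}}=[\![\mathscr b]\!]_{X\cup\{a\}}$, $\mathrm{FN}(\mathscr d_i)\subseteq\{a\}$ and $\mathrm{FN}(\mathscr e_i)\subseteq X$ for all $i$, and $[\![\mathscr e_i]\!]_X\cap[\![\mathscr e_j]\!]_X=\emptyset$ whenever $i\neq j$. -}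

module Defs where

open import Level using (0ℓ)
open import Data.Nat using (ℕ)
open import Data.Bool using (Bool; true)
open import Data.Fin using (Fin; zero; suc)
open import Data.List using (List; []; _∷_; _++_)
open import Data.List.Membership.Propositional using (_∈_)
open import Data.List.Relation.Unary.All using (All)
open import Data.Sum using (_⊎_)
open import Data.Product using (Σ; _×_)
open import Relation.Binary.PropositionalEquality using (_≡_)
open import Relation.Nullary using (¬_)
open import Relation.Unary using (Pred; _∩_; _∪_; ∁; U; ∅; _≐_; Empty)

module _ {Name : Set} where

  -- Named Boolean formulas; var a i is x^a_i.
  data Formula : Set where
    var  : Name → ℕ → Formula
    ⊤f   : Formula
    ⊥f   : Formula
    ¬f_  : Formula → Formula
    _∧f_ : Formula → Formula → Formula
    _∨f_ : Formula → Formula → Formula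

  FN : Formula → List Name
  FN (var a i) = a ∷ []
  FN ⊤f = []
  FN ⊥f = []
  FN (¬f b) = FN b
  FN (b ∧f c) = FN b ++ FN c
  FN (b ∨f c) = FN b ++ FN c

  _FN⊆_ : Formula → Pred Name 0ℓ → Set
  b FN⊆ S = All S (FN b)

  Mem : List Name → Pred Name 0ℓ
  Mem X n = n ∈ X

  Ext : List Name → Name → Pred Name 0ℓ
  Ext X a n = n ∈ X ⊎ n ≡ a

  Only : Name → Pred Name 0ℓ
  Only a n = n ≡ a

  -- Assignments: maps from names to infinite bit sequences 2^ω.
  Assignment : Set
  Assignment = Name → ℕ → Bool

  ⟦_⟧ : Formula → Pred Assignment 0ℓ
  ⟦ var a i ⟧ f = f a i ≡ true
  ⟦ ⊤f ⟧ = U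
  ⟦ ⊥f ⟧ = ∅
  ⟦ ¬f b ⟧ = ∁ ⟦ b ⟧
  ⟦ b ∧f c ⟧ = ⟦ b ⟧ ∩ ⟦ c ⟧
  ⟦ b ∨f c ⟧ = ⟦ b ⟧ ∪ ⟦ c ⟧

  ⋁ : (k : ℕ) → (Fin k → Formula) → Formula
  ⋁ ℕ.zero g = ⊥f
  ⋁ (ℕ.suc k) g = g zero ∨f ⋁ k (λ i → g (suc i))

  record Decomposition (X : List Name) (a : Name) (b : Formula) : Set where
    field
      k : ℕ
      d : Fin k → Formula
      e : Fin k → Formula
    c : Formula
    c = ⋁ k (λ i → d i ∧f e i)
    field
      sem-eq   : ⟦ c ⟧ ≐ ⟦ b ⟧
      d-names  : ∀ i → d i FN⊆ Only a
      e-names  : ∀ i → e i FN⊆ Mem X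
      disjoint : ∀ i j → ¬ i ≡ j → Empty (⟦ e i ⟧ ∩ ⟦ e j ⟧)

{-# OPTIONS --safe #-}
-- A decomposition is built by structural induction, strengthened so that the
-- formulas e_i over X are a partition of the assignments (disjoint and
-- covering) and b agrees with d_i on the i-th block. Negation then just negates
-- each d_i on the same partition, and a binary connective is handled on the
-- common refinement of the two partitions, whose blocks are the intersections
-- e_i ∧ e'_j. Covering is what makes ⋁ (d_i ∧ e_i) capture all of ⟦ b ⟧.
module Submission where

open import Level using (0ℓ)
open import Defs
open import Data.Nat using (ℕ; _*_)
open import Data.Bool using (true; false)
open import Data.Bool.Properties using (not-¬)
open import Data.Empty using (⊥-elim)
open import Data.Unit using (tt)
open import Data.Fin using (Fin; zero; suc; combine; remQuot)
open import Data.Fin.Properties using (remQuot-combine; combine-remQuot)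
open import Data.List using (List)
open import Data.List.Membership.Propositional using (_∉_)
open import Data.List.Relation.Unary.All using ([]; _∷_)
open import Data.List.Relation.Unary.All.Properties using (++⁺; ++⁻)
open import Data.Product using (Σ; ∃; _,_; proj₂; uncurry; map₂; zip)
open import Data.Product.Function.NonDependent.Propositional using (_×-⇔_)
open import Data.Sum using (inj₁; inj₂)
open import Data.Sum.Function.Propositional using (_⊎-⇔_)
open import Function.Bundles using (_⇔_; mk⇔; Equivalence)
open import Function.Construct.Identity using (⇔-id)
open import Function.Related.TypeIsomorphisms using (¬-cong-⇔)
open import Relation.Binary.PropositionalEquality using (_≡_; refl; sym; trans; cong; cong₂; subst)
open import Relation.Unary using (Pred; _∪_)

remQuot-injective : ∀ {m} n {p q : Fin (m * n)} → remQuot {m} n p ≡ remQuot n q → p ≡ q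
remQuot-injective {m} n {p} {q} eq =
  trans (sym (combine-remQuot {m} n p))
        (trans (cong (uncurry combine) eq) (combine-remQuot {m} n q))

module _ {Name : Set} where

  ⋁⁻ : ∀ k (g : Fin k → Formula {Name}) {f} → ⟦ ⋁ k g ⟧ f → ∃ λ i → ⟦ g i ⟧ f
  ⋁⁻ (ℕ.suc k) g (inj₁ p) = zero , p
  ⋁⁻ (ℕ.suc k) g (inj₂ p) with ⋁⁻ k (λ i → g (suc i)) p
  ... | i , q = suc i , q

  ⋁⁺ : ∀ k (g : Fin k → Formula {Name}) {f} i → ⟦ g i ⟧ f → ⟦ ⋁ k g ⟧ f
  ⋁⁺ (ℕ.suc k) g zero    p = inj₁ p
  ⋁⁺ (ℕ.suc k) g (suc i) p = inj₂ (⋁⁺ k (λ i → g (suc i)) i p)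

  record Partition (S : Pred Name 0ℓ) : Set where
    field
      k           : ℕ
      block       : Fin k → Formula
      block-names : ∀ i → block i FN⊆ S
      covers      : ∀ f → ∃ λ i → ⟦ block i ⟧ f
      unique      : ∀ {f i j} → ⟦ block i ⟧ f → ⟦ block j ⟧ f → i ≡ j

  open Partition

  module _ {S : Pred Name 0ℓ} where

    whole : Partition S
    whole = record
      { k = 1 ; block = λ _ → ⊤f ; block-names = λ _ → []
      ; covers = λ _ → zero , _ ; unique = λ { {i = zero} {zero} _ _ → refl } }

    split : ∀ n i → S n → Partition S
    split n i n∈S = record
      { k = 2 ; block = block′ ; block-names = λ { zero → n∈S ∷ [] ; (suc zero) → n∈S ∷ [] }
      ; covers = covers′ ; unique = unique′ }
      where
        block′ : Fin 2 → Formula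
        block′ zero    = var n i
        block′ (suc _) = ¬f var n i

        covers′ : ∀ f → ∃ λ j → ⟦ block′ j ⟧ f
        covers′ f with f n i in eq
        ... | true  = zero , eq
        ... | false = suc zero , not-¬ eq

        unique′ : ∀ {f j j′} → ⟦ block′ j ⟧ f → ⟦ block′ j′ ⟧ f → j ≡ j′
        unique′ {j = zero}     {zero}     _ _ = refl
        unique′ {j = zero}     {suc zero} x ¬x = ⊥-elim (¬x x)
        unique′ {j = suc zero} {zero}     ¬x x = ⊥-elim (¬x x)
        unique′ {j = suc zero} {suc zero} _ _ = refl

    _⊗_ : Partition S → Partition S → Partition S
    P ⊗ Q = record
      { k = k P * k Q
      ; block = λ p → pair (remQuot (k Q) p)
      ; block-names = λ p → ++⁺ (block-names P _) (block-names Q _)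
      ; covers = covers′
      ; unique = λ (x , y) (x′ , y′) →
          remQuot-injective (k Q) (cong₂ _,_ (unique P x x′) (unique Q y y′)) }
      where
        pair : Σ (Fin (k P)) (λ _ → Fin (k Q)) → Formula
        pair (i , j) = block P i ∧f block Q j

        covers′ : ∀ f → ∃ λ p → ⟦ pair (remQuot (k Q) p) ⟧ f
        covers′ f with covers P f | covers Q f
        ... | i , x | j , y =
          combine i j , subst (λ ij → ⟦ pair ij ⟧ f) (sym (remQuot-combine i j)) (x , y)

  record Piecewise (T : Pred Name 0ℓ) {S : Pred Name 0ℓ} (P : Partition S) (b : Formula) : Set where
    field
      piece       : Fin (k P) → Formula
      piece-names : ∀ i → piece i FN⊆ T
      agrees      : ∀ {f} i → ⟦ block P i ⟧ f → ⟦ piece i ⟧ f ⇔ ⟦ b ⟧ f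

  open Piecewise

  module _ {S T : Pred Name 0ℓ} where

    const-piecewise : ∀ {P : Partition S} c → c FN⊆ T → Piecewise T P c
    const-piecewise c c-names = record
      { piece = λ _ → c ; piece-names = λ _ → c-names ; agrees = λ _ _ → ⇔-id _ }

    var-piecewise : ∀ {n} i (n∈S : S n) → Piecewise T (split {S = S} n i n∈S) (var n i)
    var-piecewise i n∈S = record
      { piece = λ { zero → ⊤f ; (suc _) → ⊥f }
      ; piece-names = λ { zero → [] ; (suc _) → [] }
      ; agrees = λ { zero x → mk⇔ (λ _ → x) (λ _ → tt)
                   ; (suc zero) ¬x → mk⇔ (λ ()) ¬x } }

    ¬-piecewise : ∀ {P : Partition S} {b} → Piecewise T P b → Piecewise T P (¬f b)
    ¬-piecewise B = record
      { piece = λ i → ¬f piece B i ; piece-names = piece-names B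
      ; agrees = λ i x → ¬-cong-⇔ (agrees B i x) }

    ∧-piecewise : ∀ {P Q : Partition S} {b c} →
      Piecewise T P b → Piecewise T Q c → Piecewise T (P ⊗ Q) (b ∧f c)
    ∧-piecewise {Q = Q} B C = record
      { piece = λ p → let (i , j) = remQuot (k Q) p in piece B i ∧f piece C j
      ; piece-names = λ p → ++⁺ (piece-names B _) (piece-names C _)
      ; agrees = λ p (x , y) → agrees B _ x ×-⇔ agrees C _ y }

    ∨-piecewise : ∀ {P Q : Partition S} {b c} →
      Piecewise T P b → Piecewise T Q c → Piecewise T (P ⊗ Q) (b ∨f c)
    ∨-piecewise {Q = Q} B C = record
      { piece = λ p → let (i , j) = remQuot (k Q) p in piece B i ∨f piece C j
      ; piece-names = λ p → ++⁺ (piece-names B _) (piece-names C _)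
      ; agrees = λ p (x , y) → agrees B _ x ⊎-⇔ agrees C _ y }

    piecewise : ∀ b → b FN⊆ (S ∪ T) → Σ (Partition S) λ P → Piecewise T P b
    piecewise (var n i) (inj₁ n∈S ∷ []) = split {S = S} n i n∈S , var-piecewise i n∈S
    piecewise (var n i) (inj₂ n∈T ∷ []) = whole , const-piecewise (var n i) (n∈T ∷ [])
    piecewise ⊤f _ = whole , const-piecewise ⊤f []
    piecewise ⊥f _ = whole , const-piecewise ⊥f []
    piecewise (¬f b) h = map₂ ¬-piecewise (piecewise b h)
    piecewise (b ∧f c) h with ++⁻ (FN b) h
    ... | hb , hc = zip _⊗_ ∧-piecewise (piecewise b hb) (piecewise c hc)
    piecewise (b ∨f c) h with ++⁻ (FN b) h
    ... | hb , hc = zip _⊗_ ∨-piecewise (piecewise b hb) (piecewise c hc)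

  toDecomposition : ∀ {X a b} {P : Partition (Mem X)} → Piecewise (Only a) P b → Decomposition X a b
  toDecomposition {b = b} {P} B = record
    { k = k P ; d = piece B ; e = block P
    ; sem-eq = sound , complete
    ; d-names = piece-names B ; e-names = block-names P
    ; disjoint = λ i j i≢j f (x , y) → i≢j (unique P x y) }
    where
      sound : ∀ {f} → ⟦ ⋁ (k P) (λ i → piece B i ∧f block P i) ⟧ f → ⟦ b ⟧ f
      sound u with ⋁⁻ (k P) _ u
      ... | i , d , e = Equivalence.to (agrees B i e) d

      complete : ∀ {f} → ⟦ b ⟧ f → ⟦ ⋁ (k P) (λ i → piece B i ∧f block P i) ⟧ f
      complete {f} x with covers P f
      ... | i , e = ⋁⁺ (k P) _ i (Equivalence.from (agrees B i e) x , e)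

lemma4 : {Name : Set} (X : List Name) (a : Name) → a ∉ X →
    (b : Formula {Name}) → b FN⊆ Ext X a → Decomposition X a b
lemma4 X a _ b h = toDecomposition (proj₂ (piecewise b h))
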